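{- Let $d_1,d_2,d_3,d_4,d_5$ be pairwise distinct elements of $\{1,\dots,\lfloor u/2\rfloor\}\setminus\{\frac u2\}$ such that $d_3=d_2-d_1$ or $d_1+d_2+d_3=u$. Then the graph $\langle \mathbb Z_u\cup\{\infty\},\{d_1,d_2,d_3,d_4,d_5\}\rangle$ can be decomposed into $3$-suns.
   Context: A $3$-sun is the graph on six vertices $a,b,c,d,e,f$ with edges $\{a,b\},\{b,c\},\{c,a\},\{a,d\},\{b,e\},\{c,f\}$; a decomposition of a graph into $3$-suns is a partition of its edge set into subgraphs isomorphic to a $3$-sun. For a positive integer $u$, $\mathbb Z_u=\{0,1,\dots,u-1\}$ (integers mod $u$), and for distinct $i,j\in\mathbb Z_u$, $|i-j|_u=\min\{|i-j|,u-|i-j|\}$. For a set $H$ disjoint from $\mathbb Z_u$ and a nonempty set $D\subseteq\{1,\dots,\lfloor u/2\rfloor\}$, $\langle \mathbb Z_u\cup H,D\rangle$ is the graph with vertex set $\mathbb Z_u\cup H$ and edge set $\{\{i,j\}: i,j\in\mathbb Z_u,\ |i-j|_u\in D\}\cup\{\{\infty,i\}:\infty\in H,\ i\in\mathbb Z_u\}$. -}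

module Defs where

open import Data.Nat using (ℕ; _∸_; ∣_-_∣; _⊓_)
open import Data.Fin using (Fin; toℕ)
import Data.Fin as F
open import Data.Bool using (Bool; _∧_; _∨_)
open import Data.List using (List; []; _∷_; length; filterᵇ; concatMap)
open import Data.List.Membership.Propositional using (_∈_)
open import Data.List.Relation.Unary.All using (All)
open import Data.List.Relation.Unary.Unique.Propositional using (Unique)
open import Data.Product using (_×_; _,_; Σ)
open import Data.Unit using (⊤)
open import Data.Empty using (⊥)
open import Relation.Nullary using (¬_; yes; no; Dec)
open import Relation.Nullary.Decidable using (⌊_⌋)
open import Relation.Binary.PropositionalEquality using (_≡_; _≢_; refl; cong)
open import Relation.Binary.Definitions using (DecidableEquality)

data Vtx (u : ℕ) : Set where
  fin : Fin u → Vtx u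
  ∞   : Vtx u

_≟ᵥ_ : {u : ℕ} → DecidableEquality (Vtx u)
fin i ≟ᵥ fin j with i F.≟ j
... | yes refl = yes refl
... | no i≢j = no (λ { refl → i≢j refl })
fin i ≟ᵥ ∞ = no (λ ())
∞ ≟ᵥ fin j = no (λ ())
∞ ≟ᵥ ∞ = yes refl

dist : (u : ℕ) → Fin u → Fin u → ℕ
dist u i j = ∣ toℕ i - toℕ j ∣ ⊓ (u ∸ ∣ toℕ i - toℕ j ∣)

Adj : (u : ℕ) → List ℕ → Vtx u → Vtx u → Set
Adj u D (fin i) (fin j) = (i ≢ j) × (dist u i j ∈ D)
Adj u D (fin i) ∞ = ⊤
Adj u D ∞ (fin j) = ⊤
Adj u D ∞ ∞ = ⊥

record Sun (u : ℕ) : Set where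
  constructor sun
  field
    a b c d e f : Vtx u

sunVerts : {u : ℕ} → Sun u → List (Vtx u)
sunVerts (sun a b c d e f) = a ∷ b ∷ c ∷ d ∷ e ∷ f ∷ []

sunEdges : {u : ℕ} → Sun u → List (Vtx u × Vtx u)
sunEdges (sun a b c d e f) =
  (a , b) ∷ (b , c) ∷ (c , a) ∷ (a , d) ∷ (b , e) ∷ (c , f) ∷ []

sameEdge : {u : ℕ} → Vtx u → Vtx u → Vtx u × Vtx u → Bool
sameEdge x y (p , q) =
  (⌊ p ≟ᵥ x ⌋ ∧ ⌊ q ≟ᵥ y ⌋) ∨ (⌊ p ≟ᵥ y ⌋ ∧ ⌊ q ≟ᵥ x ⌋)

edgeMult : {u : ℕ} → List (Sun u) → Vtx u → Vtx u → ℕ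
edgeMult L x y = length (filterᵇ (sameEdge x y) (concatMap sunEdges L))

IsSunDecomposition : (u : ℕ) → List ℕ → List (Sun u) → Set
IsSunDecomposition u D L =
  All (λ s → Unique (sunVerts s)) L ×
  ((x y : Vtx u) → x ≢ y →
     (Adj u D x y → edgeMult L x y ≡ 1) × (¬ Adj u D x y → edgeMult L x y ≡ 0))

SunDecomposable : (u : ℕ) → List ℕ → Set
SunDecomposable u D = Σ (List (Sun u)) (IsSunDecomposition u D)

module Submission where

-- Take the base sun with triangle a, b = 0, c = d₂, the pendant ∞ at a, e at b and
-- f = d₂ + d₅ at c, where a = d₁ if d₃ = d₂ − d₁ and a = −d₁ if d₁ + d₂ + d₃ = u (in both
-- cases c − a ≡ ±d₃ mod u), and e = ±d₄ with the sign chosen so that e ≠ f.  Its five finite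
-- edges have the differences d₁, …, d₅, and its vertices are distinct because ±dᵢ ≢ ±dⱼ
-- (mod u) for distinct dᵢ, dⱼ < u/2.  Its u translates decompose the graph: when 2δ < u the
-- translates of an edge of difference δ cover every edge at distance δ exactly once and no
-- other edge, and the translates of {a, ∞} cover every edge {i, ∞} exactly once.

open import Defs
open import Data.Bool using (Bool; true; false; _∧_; _∨_)
open import Data.Bool.Properties using (¬-not; ∨-comm; ∧-comm; ∨-identityʳ; ∧-zeroʳ)
open import Data.Empty using (⊥; ⊥-elim)
open import Data.Fin using (Fin; toℕ)
open import Data.Fin.Properties using (toℕ-fromℕ<; toℕ-injective; toℕ<n)
open import Data.List using (List; []; _∷_; _++_; map; length; filterᵇ; concatMap; applyDownFrom)
open import Data.List.Properties using (map-++; map-cong; map-∘)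
open import Data.List.Membership.Propositional using (_∈_; _∉_)
open import Data.List.Relation.Unary.All using (All; []; _∷_)
import Data.List.Relation.Unary.All as All
open import Data.List.Relation.Unary.All.Properties using (All¬⇒¬Any; applyDownFrom⁺₂)
open import Data.List.Relation.Unary.AllPairs using ([]; _∷_)
open import Data.List.Relation.Unary.Any using (here; there)
open import Data.List.Relation.Unary.Unique.Propositional using (Unique)
open import Data.Nat
open import Data.Nat.DivMod
open import Data.Nat.ListAction using (sum)
open import Data.Nat.ListAction.Properties using (sum-++)
open import Data.Nat.Properties
open import Algebra.Properties.CommutativeSemigroup +-commutativeSemigroup
  using () renaming (interchange to +-interchange; x∙yz≈y∙xz to m+[n+o]≡n+[m+o]; xy∙z≈xz∙y to m+n+o≡m+o+n)
open import Data.Product using (_×_; _,_; Σ; proj₁)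
open import Data.Sum using (_⊎_; inj₁; inj₂; [_,_]′)
import Data.Sum as Sum
open import Function using (_∘_)
open import Function.Bundles using (_⇔_; Equivalence; mk⇔)
open import Relation.Binary using (tri<; tri≈; tri>)
open import Relation.Binary.PropositionalEquality
open import Relation.Nullary using (Dec; yes; no; ¬_; contradiction)
open import Relation.Nullary.Decidable using (⌊_⌋; isYes≗does; dec-true; dec-false; does-⇔)

-- Indicators and counting

fromBool : Bool → ℕ
fromBool true  = 1
fromBool false = 0

⌊⌋-true : ∀ {a} {A : Set a} (a? : Dec A) → A → ⌊ a? ⌋ ≡ true
⌊⌋-true a? a = trans (isYes≗does a?) (dec-true a? a)

⌊⌋-false : ∀ {a} {A : Set a} (a? : Dec A) → ¬ A → ⌊ a? ⌋ ≡ false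
⌊⌋-false a? ¬a = trans (isYes≗does a?) (dec-false a? ¬a)

⌊⌋-⇔ : ∀ {a b} {A : Set a} {B : Set b} → A ⇔ B → (a? : Dec A) (b? : Dec B) → ⌊ a? ⌋ ≡ ⌊ b? ⌋
⌊⌋-⇔ A⇔B a? b? = trans (isYes≗does a?) (trans (does-⇔ A⇔B a? b?) (sym (isYes≗does b?)))

⌊⌋-∧-true : ∀ {a} {A : Set a} {b} (a? : Dec A) → ⌊ a? ⌋ ∧ b ≡ true → A
⌊⌋-∧-true (yes a) _ = a

fromBool-⊎ : ∀ {A B C : Set} (a? : Dec A) (b? : Dec B) (c? : Dec C) →
             (C → A ⊎ B) → (A → C) → (B → C) → ¬ (A × B) →
             fromBool ⌊ a? ⌋ + fromBool ⌊ b? ⌋ ≡ fromBool ⌊ c? ⌋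
fromBool-⊎ (yes a)  (yes b)  _       _     _   _   excl = contradiction (a , b) excl
fromBool-⊎ (yes _)  (no _)   (yes _) _     _   _   _    = refl
fromBool-⊎ (yes a)  (no _)   (no ¬c) _     A→C _   _    = contradiction (A→C a) ¬c
fromBool-⊎ (no _)   (yes _)  (yes _) _     _   _   _    = refl
fromBool-⊎ (no _)   (yes b)  (no ¬c) _     _   B→C _    = contradiction (B→C b) ¬c
fromBool-⊎ (no _)   (no _)   (no _)  _     _   _   _    = refl
fromBool-⊎ (no ¬a)  (no ¬b)  (yes c) C→A⊎B _   _   _    = contradiction (C→A⊎B c) [ ¬a , ¬b ]′

count : (ℕ → Bool) → ℕ → ℕ
count p zero    = 0
count p (suc k) = fromBool (p k) + count p k

count-cong : ∀ {p q} k → p ≗ q → count p k ≡ count q k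
count-cong zero    p≗q = refl
count-cong (suc k) p≗q = cong₂ _+_ (cong fromBool (p≗q k)) (count-cong k p≗q)

count-false : ∀ {p} k → (∀ {t} → t < k → p t ≡ false) → count p k ≡ 0
count-false zero    _ = refl
count-false (suc k) p≡false rewrite p≡false ≤-refl =
  count-false k (λ t<k → p≡false (m<n⇒m<1+n t<k))

count-∨ : ∀ {p q} k → (∀ t → p t ≡ true → q t ≡ true → ⊥) →
          count (λ t → p t ∨ q t) k ≡ count p k + count q k
count-∨ zero _ = refl
count-∨ {p} {q} (suc k) disjoint with p k in pk | q k in qk
... | true  | true  = ⊥-elim (disjoint k pk qk)
... | true  | false = cong suc (count-∨ k disjoint)
... | false | true  = trans (cong suc (count-∨ k disjoint)) (sym (+-suc (count p k) (count q k)))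
... | false | false = count-∨ k disjoint

count-unique : ∀ {p s} k → s < k → (∀ {t} → t < k → p t ≡ true → t ≡ s) →
               count p k ≡ fromBool (p s)
count-unique {p} {s} (suc k) s<1+k unique with k ≟ s
... | yes refl = trans (cong (fromBool (p k) +_) (count-false k below)) (+-identityʳ _)
  where
  below : ∀ {t} → t < k → p t ≡ false
  below t<k = ¬-not (λ pt → <-irrefl (unique (m<n⇒m<1+n t<k) pt) t<k)
... | no k≢s rewrite ¬-not {p k} (λ pk → k≢s (unique ≤-refl pk)) =
  count-unique k (≤∧≢⇒< (≤-pred s<1+k) (k≢s ∘ sym)) (λ t<k → unique (m<n⇒m<1+n t<k))

multiplicity : ℕ → List ℕ → ℕ
multiplicity d Δ = sum (map (λ δ → fromBool ⌊ d ≟ δ ⌋) Δ)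

multiplicity-∉ : ∀ {d} Δ → d ∉ Δ → multiplicity d Δ ≡ 0
multiplicity-∉     []      _   = refl
multiplicity-∉ {d} (δ ∷ Δ) d∉Δ =
  cong₂ _+_ (cong fromBool (⌊⌋-false (d ≟ δ) (d∉Δ ∘ here))) (multiplicity-∉ Δ (d∉Δ ∘ there))

multiplicity-∈ : ∀ {d Δ} → Unique Δ → d ∈ Δ → multiplicity d Δ ≡ 1
multiplicity-∈ {d} {_ ∷ Δ} (d∉Δ ∷ _) (here refl) =
  cong₂ _+_ (cong fromBool (⌊⌋-true (d ≟ d) refl)) (multiplicity-∉ Δ (All¬⇒¬Any d∉Δ))
multiplicity-∈ {d} {δ ∷ _} (δ∉Δ ∷ unique) (there d∈Δ) =
  cong₂ _+_ (cong fromBool (⌊⌋-false (d ≟ δ) λ { refl → All¬⇒¬Any δ∉Δ d∈Δ }))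
            (multiplicity-∈ unique d∈Δ)

2*m<n⇒m<n : ∀ m {n} → 2 * m < n → m < n
2*m<n⇒m<n m {n} = ≤-<-trans (m≤m*n m 2) ∘ subst (_< n) (*-comm 2 m)

2*m<n⇒m+m<n : ∀ m {n} → 2 * m < n → m + m < n
2*m<n⇒m+m<n m {n} = subst (_< n) (cong (m +_) (+-identityʳ m))

2*m<o⇒2*n<o⇒m+n<o : ∀ m n {o} → 2 * m < o → 2 * n < o → m + n < o
2*m<o⇒2*n<o⇒m+n<o m n {o} 2m<o 2n<o = *-cancelˡ-< 2 (m + n) o (begin-strict
  2 * (m + n)   ≡⟨ *-distribˡ-+ 2 m n ⟩
  2 * m + 2 * n <⟨ +-mono-< 2m<o 2n<o ⟩
  o + o         ≡⟨ cong (o +_) (+-identityʳ o) ⟨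
  2 * o         ∎)
  where open ≤-Reasoning

≤/2∧≢⇒2*< : ∀ {d u} → d ≤ u / 2 → 2 * d ≢ u → 2 * d < u
≤/2∧≢⇒2*< {d} {u} d≤u/2 = ≤∧≢⇒< (begin
  2 * d       ≤⟨ *-monoʳ-≤ 2 d≤u/2 ⟩
  2 * (u / 2) ≡⟨ *-comm 2 (u / 2) ⟩
  u / 2 * 2   ≤⟨ m/n*n≤m u 2 ⟩
  u           ∎)
  where open ≤-Reasoning

⊓-∸-≡⇔ : ∀ {n k δ} → k ≤ n → 2 * δ < n → (k ⊓ (n ∸ k) ≡ δ ⇔ (δ ≡ k ⊎ k + δ ≡ n))
⊓-∸-≡⇔ {n} {k} {δ} k≤n 2δ<n = mk⇔ to from
  where
  to : k ⊓ (n ∸ k) ≡ δ → δ ≡ k ⊎ k + δ ≡ n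
  to eq with ⊓-sel k (n ∸ k)
  ... | inj₁ min≡k   = inj₁ (trans (sym eq) min≡k)
  ... | inj₂ min≡n∸k = inj₂ (trans (cong (k +_) (trans (sym eq) min≡n∸k)) (m+[n∸m]≡n k≤n))
  from : δ ≡ k ⊎ k + δ ≡ n → k ⊓ (n ∸ k) ≡ δ
  from (inj₁ refl)  = m≤n⇒m⊓n≡m (m+n≤o⇒m≤o∸n δ (<⇒≤ (2*m<n⇒m+m<n δ 2δ<n)))
  from (inj₂ k+δ≡n) = trans (cong (k ⊓_) n∸k≡δ) (m≥n⇒m⊓n≡n (<⇒≤ δ<k))
    where
    n∸k≡δ : n ∸ k ≡ δ
    n∸k≡δ = trans (cong (_∸ k) (sym k+δ≡n)) (m+n∸m≡n k δ)
    δ<k : δ < k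
    δ<k = +-cancelʳ-< δ δ k (subst (δ + δ <_) (sym k+δ≡n) (2*m<n⇒m+m<n δ 2δ<n))

-- Edge multiplicities of a family of suns

sameEdge-sym : ∀ {u} (v w : Vtx u) e → sameEdge v w e ≡ sameEdge w v e
sameEdge-sym v w (p , q) = ∨-comm (⌊ p ≟ᵥ v ⌋ ∧ ⌊ q ≟ᵥ w ⌋) (⌊ p ≟ᵥ w ⌋ ∧ ⌊ q ≟ᵥ v ⌋)

sameEdge-swap : ∀ {u} (v w p q : Vtx u) → sameEdge v w (p , q) ≡ sameEdge v w (q , p)
sameEdge-swap v w p q =
  trans (∨-comm (⌊ p ≟ᵥ v ⌋ ∧ ⌊ q ≟ᵥ w ⌋) (⌊ p ≟ᵥ w ⌋ ∧ ⌊ q ≟ᵥ v ⌋))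
        (cong₂ _∨_ (∧-comm ⌊ p ≟ᵥ w ⌋ ⌊ q ≟ᵥ v ⌋) (∧-comm ⌊ p ≟ᵥ v ⌋ ⌊ q ≟ᵥ w ⌋))

length-filterᵇ : ∀ {A : Set} (p : A → Bool) xs → length (filterᵇ p xs) ≡ sum (map (fromBool ∘ p) xs)
length-filterᵇ p []       = refl
length-filterᵇ p (x ∷ xs) with p x
... | true  = cong suc (length-filterᵇ p xs)
... | false = length-filterᵇ p xs

sum-map-+ : ∀ {A : Set} (f g : A → ℕ) xs →
            sum (map f xs) + sum (map g xs) ≡ sum (map (λ x → f x + g x) xs)
sum-map-+ f g []       = refl
sum-map-+ f g (x ∷ xs) =
  trans (+-interchange (f x) (sum (map f xs)) (g x) (sum (map g xs)))
        (cong (f x + g x +_) (sum-map-+ f g xs))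

module _ {u : ℕ} where

  sunEdgeSelectors : List (Sun u → Vtx u × Vtx u)
  sunEdgeSelectors =
    (λ s → a s , b s) ∷ (λ s → b s , c s) ∷ (λ s → c s , a s) ∷
    (λ s → a s , d s) ∷ (λ s → b s , e s) ∷ (λ s → c s , f s) ∷ []
    where open Sun

  sunEdges-selectors : (s : Sun u) → sunEdges s ≡ map (λ ε → ε s) sunEdgeSelectors
  sunEdges-selectors s = refl

  edgeMult≡sum : ∀ (L : List (Sun u)) x y →
                 edgeMult L x y ≡ sum (map (fromBool ∘ sameEdge x y) (concatMap sunEdges L))
  edgeMult≡sum L x y = length-filterᵇ (sameEdge x y) (concatMap sunEdges L)

  edgeMult-sym : ∀ (L : List (Sun u)) x y → edgeMult L x y ≡ edgeMult L y x
  edgeMult-sym L x y = begin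
    edgeMult L x y                                ≡⟨ edgeMult≡sum L x y ⟩
    sum (map (fromBool ∘ sameEdge x y) edges)     ≡⟨ cong sum (map-cong (cong fromBool ∘ sameEdge-sym x y) edges) ⟩
    sum (map (fromBool ∘ sameEdge y x) edges)     ≡⟨ edgeMult≡sum L y x ⟨
    edgeMult L y x                                ∎
    where
    open ≡-Reasoning
    edges = concatMap sunEdges L

  edgeMult-applyDownFrom : ∀ (S : ℕ → Sun u) k x y →
    edgeMult (applyDownFrom S k) x y
      ≡ sum (map (λ ε → count (λ t → sameEdge x y (ε (S t))) k) sunEdgeSelectors)
  edgeMult-applyDownFrom S zero    x y = refl
  edgeMult-applyDownFrom S (suc k) x y = begin
    edgeMult (applyDownFrom S (suc k)) x y
      ≡⟨ edgeMult≡sum (applyDownFrom S (suc k)) x y ⟩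
    sum (map P (sunEdges (S k) ++ rest))
      ≡⟨ cong sum (map-++ P (sunEdges (S k)) rest) ⟩
    sum (map P (sunEdges (S k)) ++ map P rest)
      ≡⟨ sum-++ (map P (sunEdges (S k))) (map P rest) ⟩
    sum (map P (sunEdges (S k))) + sum (map P rest)
      ≡⟨ cong₂ _+_ (cong (sum ∘ map P) (sunEdges-selectors (S k)))
                   (trans (sym (edgeMult≡sum (applyDownFrom S k) x y)) (edgeMult-applyDownFrom S k x y)) ⟩
    sum (map P (map (λ ε → ε (S k)) sunEdgeSelectors)) + sum (map (orbit k) sunEdgeSelectors)
      ≡⟨ cong (_+ sum (map (orbit k) sunEdgeSelectors)) (cong sum (map-∘ {g = P} {f = λ ε → ε (S k)} sunEdgeSelectors)) ⟨
    sum (map (λ ε → P (ε (S k))) sunEdgeSelectors) + sum (map (orbit k) sunEdgeSelectors)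
      ≡⟨ sum-map-+ (λ ε → P (ε (S k))) (orbit k) sunEdgeSelectors ⟩
    sum (map (orbit (suc k)) sunEdgeSelectors) ∎
    where
    open ≡-Reasoning
    P = fromBool ∘ sameEdge x y
    rest = concatMap sunEdges (applyDownFrom S k)
    orbit : ℕ → (Sun u → Vtx u × Vtx u) → ℕ
    orbit n ε = count (λ t → sameEdge x y (ε (S t))) n

module Cyclic (u : ℕ) .{{_ : NonZero u}} where

  -- Arithmetic modulo u

  %-absorbˡ : ∀ m n → (m % u + n) % u ≡ (m + n) % u
  %-absorbˡ m n = begin
    (m % u + n) % u         ≡⟨ %-distribˡ-+ (m % u) n u ⟩
    (m % u % u + n % u) % u ≡⟨ cong (λ k → (k + n % u) % u) (m%n%n≡m%n m u) ⟩
    (m % u + n % u) % u     ≡⟨ %-distribˡ-+ m n u ⟨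
    (m + n) % u             ∎
    where open ≡-Reasoning

  %-absorbʳ : ∀ m n → (m + n % u) % u ≡ (m + n) % u
  %-absorbʳ m n = begin
    (m + n % u) % u ≡⟨ %-congˡ (+-comm m (n % u)) ⟩
    (n % u + m) % u ≡⟨ %-absorbˡ n m ⟩
    (n + m) % u     ≡⟨ %-congˡ (+-comm n m) ⟩
    (m + n) % u     ∎
    where open ≡-Reasoning

  +u-%-identity : ∀ {x} → x < u → (x + u) % u ≡ x
  +u-%-identity {x} x<u = trans ([m+n]%n≡m%n x u) (m<n⇒m%n≡m x<u)

  +-%-cancelˡ : ∀ t {x y} → x < u → y < u → (t + x) % u ≡ (t + y) % u → x ≡ y
  +-%-cancelˡ t {x} {y} x<u y<u eq = begin
    x                             ≡⟨ undo x<u ⟨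
    (u ∸ t % u + (t + x) % u) % u ≡⟨ cong (λ k → (u ∸ t % u + k) % u) eq ⟩
    (u ∸ t % u + (t + y) % u) % u ≡⟨ undo y<u ⟩
    y                             ∎
    where
    open ≡-Reasoning
    undo : ∀ {z} → z < u → (u ∸ t % u + (t + z) % u) % u ≡ z
    undo {z} z<u = begin
      (u ∸ t % u + (t + z) % u) % u     ≡⟨ cong (λ k → (u ∸ t % u + k) % u) (%-absorbˡ t z) ⟨
      (u ∸ t % u + (t % u + z) % u) % u ≡⟨ %-absorbʳ (u ∸ t % u) (t % u + z) ⟩
      (u ∸ t % u + (t % u + z)) % u     ≡⟨ %-congˡ (+-assoc (u ∸ t % u) (t % u) z) ⟨
      (u ∸ t % u + t % u + z) % u       ≡⟨ %-congˡ (cong (_+ z) (m∸n+n≡m (m%n≤n t u))) ⟩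
      (u + z) % u                       ≡⟨ %-congˡ (+-comm u z) ⟩
      (z + u) % u                       ≡⟨ +u-%-identity z<u ⟩
      z                                 ∎

  +-%-solution : ∀ {x i} → x ≤ u → i < u → (x + (i + (u ∸ x)) % u) % u ≡ i
  +-%-solution {x} {i} x≤u i<u = begin
    (x + (i + (u ∸ x)) % u) % u ≡⟨ %-absorbʳ x (i + (u ∸ x)) ⟩
    (x + (i + (u ∸ x))) % u     ≡⟨ %-congˡ (m+[n+o]≡n+[m+o] x i (u ∸ x)) ⟩
    (i + (x + (u ∸ x))) % u     ≡⟨ %-congˡ (cong (i +_) (m+[n∸m]≡n x≤u)) ⟩
    (i + u) % u                 ≡⟨ +u-%-identity i<u ⟩
    i                           ∎
    where open ≡-Reasoning

  %-+-swap : ∀ x δ t → ((x + δ) % u + t) % u ≡ ((x + t) % u + δ) % u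
  %-+-swap x δ t = begin
    ((x + δ) % u + t) % u ≡⟨ %-absorbˡ (x + δ) t ⟩
    (x + δ + t) % u       ≡⟨ %-congˡ (m+n+o≡m+o+n x δ t) ⟩
    (x + t + δ) % u       ≡⟨ %-absorbˡ (x + t) δ ⟨
    ((x + t) % u + δ) % u ∎
    where open ≡-Reasoning

  %-below-2u : ∀ {x} → x < u + u → x % u ≡ x ⊎ x % u + u ≡ x
  %-below-2u {x} x<2u with x <? u
  ... | yes x<u = inj₁ (m<n⇒m%n≡m x<u)
  ... | no x≮u = inj₂ (begin
    x % u + u       ≡⟨ cong (_+ u) (m≤n⇒[n∸m]%m≡n%m u≤x) ⟨
    (x ∸ u) % u + u ≡⟨ cong (_+ u) (m<n⇒m%n≡m (m<n+o⇒m∸n<o x u x<2u)) ⟩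
    x ∸ u + u       ≡⟨ m∸n+n≡m u≤x ⟩
    x               ∎)
    where
    open ≡-Reasoning
    u≤x = ≮⇒≥ x≮u

  module _ {i k δ : ℕ} (i+k<u : i + k < u) (δ<u : δ < u) where

    +-%-≡-forward⇔ : (i + δ) % u ≡ i + k ⇔ δ ≡ k
    +-%-≡-forward⇔ = mk⇔ to from
      where
      to : (i + δ) % u ≡ i + k → δ ≡ k
      to eq with %-below-2u (+-mono-< (≤-<-trans (m≤m+n i k) i+k<u) δ<u)
      ... | inj₁ no-wrap = +-cancelˡ-≡ i δ k (trans (sym no-wrap) eq)
      ... | inj₂ wrap    = contradiction (subst (u ≤_) k+u≡δ (m≤n+m u k)) (<⇒≱ δ<u)
        where
        k+u≡δ : k + u ≡ δ
        k+u≡δ = +-cancelˡ-≡ i (k + u) δ (begin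
          i + (k + u)     ≡⟨ +-assoc i k u ⟨
          i + k + u       ≡⟨ cong (_+ u) eq ⟨
          (i + δ) % u + u ≡⟨ wrap ⟩
          i + δ           ∎)
          where open ≡-Reasoning
      from : δ ≡ k → (i + δ) % u ≡ i + k
      from refl = m<n⇒m%n≡m i+k<u

    +-%-≡-backward⇔ : 0 < k → (i + k + δ) % u ≡ i ⇔ k + δ ≡ u
    +-%-≡-backward⇔ 0<k = mk⇔ to from
      where
      to : (i + k + δ) % u ≡ i → k + δ ≡ u
      to eq with %-below-2u (+-mono-< i+k<u δ<u)
      ... | inj₁ no-wrap = contradiction (trans (sym (+-assoc i k δ)) (trans (sym no-wrap) eq))
                                         (<⇒≢ (m<m+n i (<-≤-trans 0<k (m≤m+n k δ))) ∘ sym)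
      ... | inj₂ wrap    = sym (+-cancelˡ-≡ i u (k + δ) (begin
        i + u               ≡⟨ cong (_+ u) eq ⟨
        (i + k + δ) % u + u ≡⟨ wrap ⟩
        i + k + δ           ≡⟨ +-assoc i k δ ⟩
        i + (k + δ)         ∎))
        where open ≡-Reasoning
      from : k + δ ≡ u → (i + k + δ) % u ≡ i
      from k+δ≡u = trans (%-congˡ (trans (+-assoc i k δ) (cong (i +_) k+δ≡u)))
                         (+u-%-identity (≤-<-trans (m≤m+n i k) i+k<u))

  -- For j = i + k, (i + δ) mod u hits j iff δ = k, and (j + δ) mod u hits i iff k + δ = u;
  -- the distance min(k, u − k) is δ iff one of them holds, and 2δ < u excludes both at once.
  dist-indicator-< : ∀ {i j δ} → i < j → j < u → 2 * δ < u →
    fromBool ⌊ (i + δ) % u ≟ j ⌋ + fromBool ⌊ (j + δ) % u ≟ i ⌋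
      ≡ fromBool ⌊ ∣ i - j ∣ ⊓ (u ∸ ∣ i - j ∣) ≟ δ ⌋
  dist-indicator-< {i} {j} {δ} i<j j<u 2δ<u with m≤n⇒∃[o]m+o≡n (<⇒≤ i<j)
  ... | k , refl rewrite m≤n⇒∣m-n∣≡n∸m (m≤m+n i k) | m+n∸m≡n i k =
    fromBool-⊎ (_ ≟ _) (_ ≟ _) (_ ≟ _)
      (λ eq → Sum.map (from forward) (from backward) (to distance eq))
      (λ eq → from distance (inj₁ (to forward eq)))
      (λ eq → from distance (inj₂ (to backward eq)))
      (λ (eq₁ , eq₂) → <-irrefl (trans (cong (_+ δ) (to forward eq₁)) (to backward eq₂))
                                (2*m<n⇒m+m<n δ 2δ<u))
    where
    open Equivalence
    δ<u = 2*m<n⇒m<n δ 2δ<u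
    forward  = +-%-≡-forward⇔ j<u δ<u
    backward = +-%-≡-backward⇔ j<u δ<u (n≢0⇒n>0 λ { refl → <-irrefl (sym (+-identityʳ i)) i<j })
    distance = ⊓-∸-≡⇔ (≤-trans (m≤n+m k i) (<⇒≤ j<u)) 2δ<u

  dist-indicator : ∀ {i j δ} → i < u → j < u → i ≢ j → 2 * δ < u →
    fromBool ⌊ (i + δ) % u ≟ j ⌋ + fromBool ⌊ (j + δ) % u ≟ i ⌋
      ≡ fromBool ⌊ ∣ i - j ∣ ⊓ (u ∸ ∣ i - j ∣) ≟ δ ⌋
  dist-indicator {i} {j} {δ} i<u j<u i≢j 2δ<u with <-cmp i j
  ... | tri< i<j _ _ = dist-indicator-< i<j j<u 2δ<u
  ... | tri≈ _ i≡j _ = contradiction i≡j i≢j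
  ... | tri> _ _ j<i = begin
    fromBool ⌊ (i + δ) % u ≟ j ⌋ + fromBool ⌊ (j + δ) % u ≟ i ⌋
      ≡⟨ +-comm (fromBool ⌊ (i + δ) % u ≟ j ⌋) _ ⟩
    fromBool ⌊ (j + δ) % u ≟ i ⌋ + fromBool ⌊ (i + δ) % u ≟ j ⌋
      ≡⟨ dist-indicator-< j<i i<u 2δ<u ⟩
    fromBool ⌊ ∣ j - i ∣ ⊓ (u ∸ ∣ j - i ∣) ≟ δ ⌋
      ≡⟨ cong (λ d → fromBool ⌊ d ⊓ (u ∸ d) ≟ δ ⌋) (∣-∣-comm j i) ⟩
    fromBool ⌊ ∣ i - j ∣ ⊓ (u ∸ ∣ i - j ∣) ≟ δ ⌋ ∎
    where open ≡-Reasoning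

  ⟦_⟧ : ℕ → Vtx u
  ⟦ x ⟧ = fin (x mod u)

  ⟦⟧-≟-fin : ∀ x (i : Fin u) → ⌊ ⟦ x ⟧ ≟ᵥ fin i ⌋ ≡ ⌊ x % u ≟ toℕ i ⌋
  ⟦⟧-≟-fin x i = ⌊⌋-⇔ (mk⇔ to from) (⟦ x ⟧ ≟ᵥ fin i) (x % u ≟ toℕ i)
    where
    to : ⟦ x ⟧ ≡ fin i → x % u ≡ toℕ i
    to refl = sym (toℕ-fromℕ< (m%n<n x u))
    from : x % u ≡ toℕ i → ⟦ x ⟧ ≡ fin i
    from eq = cong fin (toℕ-injective (trans (toℕ-fromℕ< (m%n<n x u)) eq))

  translate-injective : ∀ t {x y} → x < u → y < u → ⟦ x + t ⟧ ≡ ⟦ y + t ⟧ → x ≡ y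
  translate-injective t {x} {y} x<u y<u eq = +-%-cancelˡ t x<u y<u (begin
    (t + x) % u         ≡⟨ %-congˡ (+-comm t x) ⟩
    (x + t) % u         ≡⟨ toℕ-fromℕ< (m%n<n (x + t) u) ⟨
    toℕ ((x + t) mod u) ≡⟨ cong toℕ (fin-injective eq) ⟩
    toℕ ((y + t) mod u) ≡⟨ toℕ-fromℕ< (m%n<n (y + t) u) ⟩
    (y + t) % u         ≡⟨ %-congˡ (+-comm y t) ⟩
    (t + y) % u         ∎)
    where
    open ≡-Reasoning
    fin-injective : ∀ {i j : Fin u} → fin i ≡ fin j → i ≡ j
    fin-injective refl = refl

  count-translate-∧ : ∀ {x i} → x < u → i < u → (p : ℕ → Bool) →
    count (λ t → ⌊ (x + t) % u ≟ i ⌋ ∧ p t) u ≡ fromBool (p ((i + (u ∸ x)) % u))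
  count-translate-∧ {x} {i} x<u i<u p =
    trans (count-unique u (m%n<n _ u) unique)
          (cong (λ b → fromBool (b ∧ p t₀)) (⌊⌋-true ((x + t₀) % u ≟ i) (+-%-solution (<⇒≤ x<u) i<u)))
    where
    t₀ = (i + (u ∸ x)) % u
    unique : ∀ {t} → t < u → ⌊ (x + t) % u ≟ i ⌋ ∧ p t ≡ true → t ≡ t₀
    unique {t} t<u hit = +-%-cancelˡ x t<u (m%n<n _ u)
      (trans (⌊⌋-∧-true ((x + t) % u ≟ i) hit) (sym (+-%-solution (<⇒≤ x<u) i<u)))

  count-translate-oriented : ∀ {x y δ} → x < u → (x + δ) % u ≡ y → {i j : Fin u} → i ≢ j →
    count (λ t → sameEdge (fin i) (fin j) (⟦ x + t ⟧ , ⟦ y + t ⟧)) u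
      ≡ fromBool ⌊ (toℕ i + δ) % u ≟ toℕ j ⌋ + fromBool ⌊ (toℕ j + δ) % u ≟ toℕ i ⌋
  count-translate-oriented {x} {y} {δ} x<u x+δ≡y {i} {j} i≢j = begin
    count (λ t → sameEdge (fin i) (fin j) (⟦ x + t ⟧ , ⟦ y + t ⟧)) u
      ≡⟨ count-cong u (λ t → cong₂ _∨_ (cong₂ _∧_ (⟦⟧-≟-fin (x + t) i) (⟦⟧-≟-fin (y + t) j))
                                        (cong₂ _∧_ (⟦⟧-≟-fin (x + t) j) (⟦⟧-≟-fin (y + t) i))) ⟩
    count (λ t → (at x t i ∧ at y t j) ∨ (at x t j ∧ at y t i)) u
      ≡⟨ count-∨ u disjoint ⟩
    count (λ t → at x t i ∧ at y t j) u + count (λ t → at x t j ∧ at y t i) u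
      ≡⟨ cong₂ _+_ (from-to i j) (from-to j i) ⟩
    fromBool ⌊ (toℕ i + δ) % u ≟ toℕ j ⌋ + fromBool ⌊ (toℕ j + δ) % u ≟ toℕ i ⌋ ∎
    where
    open ≡-Reasoning
    at : ℕ → ℕ → Fin u → Bool
    at z t k = ⌊ (z + t) % u ≟ toℕ k ⌋
    disjoint : ∀ t → at x t i ∧ at y t j ≡ true → at x t j ∧ at y t i ≡ true → ⊥
    disjoint t at-i at-j = i≢j (toℕ-injective (trans (sym (⌊⌋-∧-true ((x + t) % u ≟ toℕ i) at-i))
                                                      (⌊⌋-∧-true ((x + t) % u ≟ toℕ j) at-j)))
    from-to : ∀ k l → count (λ t → at x t k ∧ at y t l) u ≡ fromBool ⌊ (toℕ k + δ) % u ≟ toℕ l ⌋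
    from-to k l = trans (count-translate-∧ x<u (toℕ<n k) (λ t → at y t l))
      (cong (λ z → fromBool ⌊ z ≟ toℕ l ⌋) (begin
        (y + t₀) % u           ≡⟨ cong (λ z → (z + t₀) % u) x+δ≡y ⟨
        ((x + δ) % u + t₀) % u ≡⟨ %-+-swap x δ t₀ ⟩
        ((x + t₀) % u + δ) % u ≡⟨ cong (λ z → (z + δ) % u) (+-%-solution (<⇒≤ x<u) (toℕ<n k)) ⟩
        (toℕ k + δ) % u        ∎))
      where t₀ = (toℕ k + (u ∸ x)) % u

  Difference : ℕ → ℕ → ℕ → Set
  Difference δ x y = (x + δ) % u ≡ y ⊎ (y + δ) % u ≡ x

  Difference-sym : ∀ {δ x y} → Difference δ x y → Difference δ y x
  Difference-sym = Sum.swap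

  count-translate-finite : ∀ {x y δ} → x < u → y < u → 2 * δ < u → Difference δ x y →
    {i j : Fin u} → i ≢ j →
    count (λ t → sameEdge (fin i) (fin j) (⟦ x + t ⟧ , ⟦ y + t ⟧)) u ≡ fromBool ⌊ dist u i j ≟ δ ⌋
  count-translate-finite x<u y<u 2δ<u (inj₁ x+δ≡y) {i} {j} i≢j =
    trans (count-translate-oriented x<u x+δ≡y i≢j)
          (dist-indicator (toℕ<n i) (toℕ<n j) (i≢j ∘ toℕ-injective) 2δ<u)
  count-translate-finite {x} {y} x<u y<u 2δ<u (inj₂ y+δ≡x) {i} {j} i≢j =
    trans (count-cong u (λ t → sameEdge-swap (fin i) (fin j) ⟦ x + t ⟧ ⟦ y + t ⟧))
          (count-translate-finite y<u x<u 2δ<u (inj₁ y+δ≡x) i≢j)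

  count-translate-∞ : ∀ {x} → x < u → (i : Fin u) →
                      count (λ t → sameEdge (fin i) ∞ (⟦ x + t ⟧ , ∞)) u ≡ 1
  count-translate-∞ {x} x<u i =
    trans (count-cong u (λ t → trans (∨-identityʳ _) (cong (_∧ true) (⟦⟧-≟-fin (x + t) i))))
          (count-translate-∧ x<u (toℕ<n i) (λ _ → true))

  count-translate-∞-miss-finite : ∀ x (i j : Fin u) →
                                  count (λ t → sameEdge (fin i) (fin j) (⟦ x + t ⟧ , ∞)) u ≡ 0
  count-translate-∞-miss-finite x i j = count-false u λ {t} _ →
    cong₂ _∨_ (∧-zeroʳ ⌊ ⟦ x + t ⟧ ≟ᵥ fin i ⌋) (∧-zeroʳ ⌊ ⟦ x + t ⟧ ≟ᵥ fin j ⌋)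

  count-translate-finite-miss-∞ : ∀ x y (i : Fin u) →
                                  count (λ t → sameEdge (fin i) ∞ (⟦ x + t ⟧ , ⟦ y + t ⟧)) u ≡ 0
  count-translate-finite-miss-∞ x y i = count-false u λ {t} _ →
    trans (∨-identityʳ _) (∧-zeroʳ ⌊ ⟦ x + t ⟧ ≟ᵥ fin i ⌋)

  -- Developing a base sun

  record BaseSun (δ₁ δ₂ δ₃ δ₄ δ₅ : ℕ) : Set where
    field
      a b c e f : ℕ
      bounded   : All (_< u) (a ∷ b ∷ c ∷ e ∷ f ∷ [])
      distinct  : Unique (a ∷ b ∷ c ∷ e ∷ f ∷ [])
      ab : Difference δ₁ a b
      bc : Difference δ₂ b c
      ca : Difference δ₃ c a
      be : Difference δ₄ b e
      cf : Difference δ₅ c f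

  module _ {δ₁ δ₂ δ₃ δ₄ δ₅ : ℕ} (B : BaseSun δ₁ δ₂ δ₃ δ₄ δ₅) where
    open BaseSun B

    translate : ℕ → Sun u
    translate t = sun ⟦ a + t ⟧ ⟦ b + t ⟧ ⟦ c + t ⟧ ∞ ⟦ e + t ⟧ ⟦ f + t ⟧

    develop : List (Sun u)
    develop = applyDownFrom translate u

    translate-unique : ∀ t → Unique (sunVerts (translate t))
    translate-unique t with bounded | distinct
    ... | a< ∷ b< ∷ c< ∷ e< ∷ f< ∷ []
        | (a≢b ∷ a≢c ∷ a≢e ∷ a≢f ∷ []) ∷ (b≢c ∷ b≢e ∷ b≢f ∷ []) ∷ (c≢e ∷ c≢f ∷ []) ∷ (e≢f ∷ []) ∷ [] ∷ [] =
        (apart a< b< a≢b ∷ apart a< c< a≢c ∷ (λ ()) ∷ apart a< e< a≢e ∷ apart a< f< a≢f ∷ []) ∷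
        (apart b< c< b≢c ∷ (λ ()) ∷ apart b< e< b≢e ∷ apart b< f< b≢f ∷ []) ∷
        ((λ ()) ∷ apart c< e< c≢e ∷ apart c< f< c≢f ∷ []) ∷
        ((λ ()) ∷ (λ ()) ∷ []) ∷
        (apart e< f< e≢f ∷ []) ∷ [] ∷ []
      where
      apart : ∀ {x y} → x < u → y < u → x ≢ y → ⟦ x + t ⟧ ≢ ⟦ y + t ⟧
      apart x<u y<u x≢y = x≢y ∘ translate-injective t x<u y<u

    develop-decomposes : All (λ δ → 2 * δ < u) (δ₁ ∷ δ₂ ∷ δ₃ ∷ δ₄ ∷ δ₅ ∷ []) →
                         Unique (δ₁ ∷ δ₂ ∷ δ₃ ∷ δ₄ ∷ δ₅ ∷ []) →
                         IsSunDecomposition u (δ₁ ∷ δ₂ ∷ δ₃ ∷ δ₄ ∷ δ₅ ∷ []) develop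
    develop-decomposes (s₁ ∷ s₂ ∷ s₃ ∷ s₄ ∷ s₅ ∷ []) unique =
      applyDownFrom⁺₂ translate u translate-unique , covers
      where
      Δ = δ₁ ∷ δ₂ ∷ δ₃ ∷ δ₄ ∷ δ₅ ∷ []

      edgeMult-fin-fin : ∀ {i j} → i ≢ j → edgeMult develop (fin i) (fin j) ≡ multiplicity (dist u i j) Δ
      edgeMult-fin-fin {i} {j} i≢j with bounded
      ... | a< ∷ b< ∷ c< ∷ e< ∷ f< ∷ [] =
        trans (edgeMult-applyDownFrom translate u (fin i) (fin j))
          (cong₂ _+_ (count-translate-finite a< b< s₁ ab i≢j)
          (cong₂ _+_ (count-translate-finite b< c< s₂ bc i≢j)
          (cong₂ _+_ (count-translate-finite c< a< s₃ ca i≢j)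
          (cong₂ _+_ (count-translate-∞-miss-finite a i j)
          (cong₂ _+_ (count-translate-finite b< e< s₄ be i≢j)
          (cong (_+ 0) (count-translate-finite c< f< s₅ cf i≢j)))))))

      edgeMult-fin-∞ : ∀ i → edgeMult develop (fin i) ∞ ≡ 1
      edgeMult-fin-∞ i with bounded
      ... | a< ∷ _ =
        trans (edgeMult-applyDownFrom translate u (fin i) ∞)
          (cong₂ _+_ (count-translate-finite-miss-∞ a b i)
          (cong₂ _+_ (count-translate-finite-miss-∞ b c i)
          (cong₂ _+_ (count-translate-finite-miss-∞ c a i)
          (cong₂ _+_ (count-translate-∞ a< i)
          (cong₂ _+_ (count-translate-finite-miss-∞ b e i)
          (cong (_+ 0) (count-translate-finite-miss-∞ c f i)))))))

      covers : ∀ x y → x ≢ y →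
               (Adj u Δ x y → edgeMult develop x y ≡ 1) × (¬ Adj u Δ x y → edgeMult develop x y ≡ 0)
      covers (fin i) (fin j) x≢y =
        (λ (_ , d∈Δ) → trans (edgeMult-fin-fin i≢j) (multiplicity-∈ unique d∈Δ)) ,
        (λ ¬adj → trans (edgeMult-fin-fin i≢j) (multiplicity-∉ Δ (λ d∈Δ → ¬adj (i≢j , d∈Δ))))
        where i≢j = x≢y ∘ cong fin
      covers (fin i) ∞       _   = (λ _ → edgeMult-fin-∞ i) , (λ ¬adj → contradiction _ ¬adj)
      covers ∞       (fin j) _   =
        (λ _ → trans (edgeMult-sym develop ∞ (fin j)) (edgeMult-fin-∞ j)) , (λ ¬adj → contradiction _ ¬adj)
      covers ∞       ∞       x≢y = contradiction refl x≢y

  -- The base sun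

  _≡±_ : ℕ → ℕ → Set
  p ≡± x = p ≡ x ⊎ p ≡ u ∸ x

  ≡±-< : ∀ {p x} → 1 ≤ x → x < u → p ≡± x → p < u
  ≡±-< _   x<u (inj₁ refl) = x<u
  ≡±-< 1≤x x<u (inj₂ refl) = ∸-monoʳ-< 1≤x (<⇒≤ x<u)

  ≡±-nonzero : ∀ {p x} → 1 ≤ x → x < u → p ≡± x → p ≢ 0
  ≡±-nonzero 1≤x _   (inj₁ refl) = ≢-sym (<⇒≢ 1≤x)
  ≡±-nonzero _   x<u (inj₂ refl) = ≢-sym (<⇒≢ (m<n⇒0<n∸m x<u))

  ≡±-injective : ∀ {p q x y} → 2 * x < u → 2 * y < u → p ≡± x → q ≡± y → p ≡ q → x ≡ y
  ≡±-injective _ _ (inj₁ refl) (inj₁ refl) x≡y = x≡y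
  ≡±-injective {x = x} {y} 2x<u 2y<u (inj₁ refl) (inj₂ refl) x≡u∸y =
    contradiction (trans (cong (_+ y) x≡u∸y) (m∸n+n≡m (<⇒≤ (2*m<n⇒m<n y 2y<u))))
                  (<⇒≢ (2*m<o⇒2*n<o⇒m+n<o x y 2x<u 2y<u))
  ≡±-injective {x = x} {y} 2x<u 2y<u (inj₂ refl) (inj₁ refl) u∸x≡y =
    contradiction (trans (cong (_+ x) (sym u∸x≡y)) (m∸n+n≡m (<⇒≤ (2*m<n⇒m<n x 2x<u))))
                  (<⇒≢ (2*m<o⇒2*n<o⇒m+n<o y x 2y<u 2x<u))
  ≡±-injective {x = x} {y} 2x<u 2y<u (inj₂ refl) (inj₂ refl) u∸x≡u∸y =
    ∸-cancelˡ-≡ (<⇒≤ (2*m<n⇒m<n x 2x<u)) (<⇒≤ (2*m<n⇒m<n y 2y<u)) u∸x≡u∸y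

  ≡±⇒Difference : ∀ {p x} → x < u → p ≡± x → Difference x 0 p
  ≡±⇒Difference x<u (inj₁ refl) = inj₁ (m<n⇒m%n≡m x<u)
  ≡±⇒Difference x<u (inj₂ refl) = inj₂ (trans (%-congˡ (m∸n+n≡m (<⇒≤ x<u))) (n%n≡0 u))

  ≡±-avoiding : ∀ {x} → 2 * x < u → ∀ z → Σ ℕ λ p → p ≡± x × p ≢ z
  ≡±-avoiding {x} 2x<u z with x ≟ z
  ... | no x≢z   = x , inj₁ refl , x≢z
  ... | yes refl = u ∸ x , inj₂ refl , λ u∸x≡x →
    <-irrefl (trans (cong (_+ x) (sym u∸x≡x)) (m∸n+n≡m (<⇒≤ (2*m<n⇒m<n x 2x<u)))) (2*m<n⇒m+m<n x 2x<u)

  triangle-apex : ∀ {d₁ d₂ d₃ d₅} → 1 ≤ d₃ → 2 * d₂ < u → 2 * d₃ < u → d₃ ≢ d₅ →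
    (d₃ + d₁ ≡ d₂) ⊎ (d₁ + d₂ + d₃ ≡ u) →
    Σ ℕ λ a → a ≡± d₁ × Difference d₃ d₂ a × a ≢ d₂ + d₅
  triangle-apex {d₁} {d₂} {d₃} {d₅} 1≤d₃ 2d₂<u _ _ (inj₁ d₃+d₁≡d₂) =
    d₁ , inj₁ refl ,
    inj₂ (trans (%-congˡ (trans (+-comm d₁ d₃) d₃+d₁≡d₂)) (m<n⇒m%n≡m (2*m<n⇒m<n d₂ 2d₂<u))) ,
    <⇒≢ (<-≤-trans (subst (d₁ <_) d₃+d₁≡d₂ (m<n+m d₁ 1≤d₃)) (m≤m+n d₂ d₅))
  triangle-apex {d₁} {d₂} {d₃} {d₅} _ 2d₂<u 2d₃<u d₃≢d₅ (inj₂ d₁+d₂+d₃≡u) =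
    u ∸ d₁ , inj₂ refl ,
    inj₁ (trans (m<n⇒m%n≡m (2*m<o⇒2*n<o⇒m+n<o d₂ d₃ 2d₂<u 2d₃<u)) (sym u∸d₁≡d₂+d₃)) ,
    λ u∸d₁≡d₂+d₅ → d₃≢d₅ (+-cancelˡ-≡ d₂ d₃ d₅ (trans (sym u∸d₁≡d₂+d₃) u∸d₁≡d₂+d₅))
    where
    u∸d₁≡d₂+d₃ : u ∸ d₁ ≡ d₂ + d₃
    u∸d₁≡d₂+d₃ = trans (cong (_∸ d₁) (trans (sym d₁+d₂+d₃≡u) (+-assoc d₁ d₂ d₃))) (m+n∸m≡n d₁ (d₂ + d₃))

  baseSun : ∀ {d₁ d₂ d₃ d₄ d₅} →
    All (1 ≤_) (d₁ ∷ d₂ ∷ d₃ ∷ d₄ ∷ d₅ ∷ []) → All (λ d → 2 * d < u) (d₁ ∷ d₂ ∷ d₃ ∷ d₄ ∷ d₅ ∷ []) →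
    Unique (d₁ ∷ d₂ ∷ d₃ ∷ d₄ ∷ d₅ ∷ []) → (d₃ + d₁ ≡ d₂) ⊎ (d₁ + d₂ + d₃ ≡ u) →
    BaseSun d₁ d₂ d₃ d₄ d₅
  baseSun {d₁} {d₂} {d₃} {d₄} {d₅} (p₁ ∷ p₂ ∷ p₃ ∷ p₄ ∷ p₅ ∷ []) (s₁ ∷ s₂ ∷ s₃ ∷ s₄ ∷ s₅ ∷ [])
          ((d₁≢d₂ ∷ _ ∷ d₁≢d₄ ∷ _ ∷ []) ∷ (_ ∷ d₂≢d₄ ∷ _ ∷ []) ∷ (_ ∷ d₃≢d₅ ∷ []) ∷ _) triangle
    with triangle-apex p₃ s₂ s₃ d₃≢d₅ triangle | ≡±-avoiding s₄ (d₂ + d₅)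
  ... | a , a≡±d₁ , ca , a≢f | e , e≡±d₄ , e≢f = record
    { a = a ; b = 0 ; c = d₂ ; e = e ; f = d₂ + d₅
    ; bounded  = ≡±-< p₁ d₁<u a≡±d₁ ∷ >-nonZero⁻¹ u ∷ d₂<u ∷ ≡±-< p₄ d₄<u e≡±d₄ ∷ f<u ∷ []
    ; distinct = (≡±-nonzero p₁ d₁<u a≡±d₁ ∷ d₁≢d₂ ∘ ≡±-injective s₁ s₂ a≡±d₁ (inj₁ refl) ∷
                   d₁≢d₄ ∘ ≡±-injective s₁ s₄ a≡±d₁ e≡±d₄ ∷ a≢f ∷ []) ∷
                 (<⇒≢ p₂ ∷ ≢-sym (≡±-nonzero p₄ d₄<u e≡±d₄) ∷ <⇒≢ (≤-trans p₂ (m≤m+n d₂ d₅)) ∷ []) ∷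
                 (d₂≢d₄ ∘ ≡±-injective s₂ s₄ (inj₁ refl) e≡±d₄ ∷ <⇒≢ (m<m+n d₂ p₅) ∷ []) ∷
                 (e≢f ∷ []) ∷ [] ∷ []
    ; ab = Difference-sym (≡±⇒Difference d₁<u a≡±d₁)
    ; bc = ≡±⇒Difference d₂<u (inj₁ refl)
    ; ca = ca
    ; be = ≡±⇒Difference d₄<u e≡±d₄
    ; cf = inj₁ (m<n⇒m%n≡m f<u)
    }
    where
    d₁<u = 2*m<n⇒m<n d₁ s₁
    d₂<u = 2*m<n⇒m<n d₂ s₂
    d₄<u = 2*m<n⇒m<n d₄ s₄
    f<u  = 2*m<o⇒2*n<o⇒m+n<o d₂ d₅ s₂ s₅

lemma2p11 : (u d₁ d₂ d₃ d₄ d₅ : ℕ) →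
    All (λ d → (1 ≤ d) × (d ≤ u / 2) × (2 * d ≢ u)) (d₁ ∷ d₂ ∷ d₃ ∷ d₄ ∷ d₅ ∷ []) →
    Unique (d₁ ∷ d₂ ∷ d₃ ∷ d₄ ∷ d₅ ∷ []) →
    (d₃ + d₁ ≡ d₂) ⊎ (d₁ + d₂ + d₃ ≡ u) →
    SunDecomposable u (d₁ ∷ d₂ ∷ d₃ ∷ d₄ ∷ d₅ ∷ [])
lemma2p11 zero      _ _ _ _ _ ((s≤s _ , () , _) ∷ _) _ _
lemma2p11 u@(suc _) _ _ _ _ _ bounds unique triangle = develop B , develop-decomposes B small unique
  where
  open Cyclic u
  small = All.map (λ (_ , d≤u/2 , 2d≢u) → ≤/2∧≢⇒2*< d≤u/2 2d≢u) bounds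
  B = baseSun (All.map proj₁ bounds) small unique triangle
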